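{- Let $P=(X,Y,R)$ be a polarity and $U$ an ultrafilter on a set $I$. Define $\theta\colon(P^+)^U\to(P^U)^+$ by $\theta(\alpha^U)=\{f^U\in X^U:\{i\in I: f(i)\in\alpha(i)\}\in U\}$ for $\alpha\in(P^+)^I$. Then $\theta$ is a MacNeille completion of the ultrapower lattice $(P^+)^U$; that is, $\theta$ is a lattice embedding into the complete lattice $(P^U)^+$ whose image is both meet-dense and join-dense in $(P^U)^+$.
   Context: A polarity is a triple $P=(X,Y,R)$ with $R\subseteq X\times Y$. For $A\subseteq X$ let $\rho A=\{y\in Y:\forall x\in A,\ xRy\}$, for $B\subseteq Y$ let $\lambda B=\{x\in X:\forall y\in B,\ xRy\}$; $A$ is stable if $\lambda\rho A=A$. $P^+$ is the complete lattice of stable subsets of $X$ under inclusion (meets are intersections, $\bigvee G=\lambda\rho(\bigcup G)$). The ultrapower $P^U=(X^U,Y^U,R^U)$ has $f^UR^Ug^U$ iff $\{i: f(i)Rg(i)\}\in U$, where $f^U$ is the class of $f$ modulo $f\sim_U g\iff\{i:f(i)=g(i)\}\in U$; $(P^+)^U$ is the lattice ultrapower. A MacNeille completion of a lattice $\mathbb{L}$ is a lattice embedding $e$ of $\mathbb{L}$ into a complete lattice such that every element of the latter is both a meet and a join of elements of $e[\mathbb{L}]$. -}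

module Defs where

open import Level using (0ℓ)
open import Data.Product using (Σ; _×_; _,_; proj₁; proj₂)
open import Data.Sum using (_⊎_; inj₁; inj₂)
open import Relation.Nullary using (¬_)
open import Relation.Unary using (Pred; _⊆_; _∩_; _∪_; ∁; _≐_; ∅; U)

record Polarity : Set₁ where
  field
    X : Set
    Y : Set
    R : X → Y → Set

module Galois {A B : Set} (R : A → B → Set) where
  ρ : Pred A 0ℓ → Pred B 0ℓ
  ρ S y = ∀ {x} → S x → R x y

  Λ : Pred B 0ℓ → Pred A 0ℓ
  Λ T x = ∀ {y} → T y → R x y

  Stable : Pred A 0ℓ → Set
  Stable S = Λ (ρ S) ≐ S

  ρ-anti : ∀ {S S′} → S ⊆ S′ → ρ S′ ⊆ ρ S
  ρ-anti h r s = r (h s)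

  Λ-anti : ∀ {T T′} → T ⊆ T′ → Λ T′ ⊆ Λ T
  Λ-anti h r t = r (h t)

  unit : ∀ {S} → S ⊆ Λ (ρ S)
  unit s r = r s

  unitʳ : ∀ {T} → T ⊆ ρ (Λ T)
  unitʳ t l = l t

  closure-stable : ∀ S → Stable (Λ (ρ S))
  closure-stable S = Λ-anti unitʳ , unit

  ∩-stable : ∀ {S T} → Stable S → Stable T → Stable (S ∩ T)
  ∩-stable {S} {T} sS sT =
    (λ x → proj₁ sS (λ r → x (ρ-anti {S ∩ T} {S} proj₁ r)) , proj₁ sT (λ r → x (ρ-anti {S ∩ T} {T} proj₂ r)))
    , unit

-- the complete lattice P⁺ of stable subsets of X
module Plus (P : Polarity) where
  open Polarity P
  open Galois R public

  Stab : Set₁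
  Stab = Σ (Pred X 0ℓ) Stable

  _∧ₛ_ : Stab → Stab → Stab
  (A , sA) ∧ₛ (B , sB) = (A ∩ B) , ∩-stable sA sB

  _∨ₛ_ : Stab → Stab → Stab
  (A , _) ∨ₛ (B , _) = Λ (ρ (A ∪ B)) , closure-stable (A ∪ B)

record Ultrafilter (I : Set) : Set₁ where
  field
    _∈U       : Pred I 0ℓ → Set
    whole     : U ∈U
    upward    : ∀ {A B} → A ⊆ B → A ∈U → B ∈U
    intersect : ∀ {A B} → A ∈U → B ∈U → (A ∩ B) ∈U
    proper    : ¬ (∅ ∈U)
    ultra     : ∀ A → (A ∈U) ⊎ (∁ A ∈U)

-- The ultrapower polarity P^U.  Elements of X^U, Y^U are represented by
-- functions I → X, I → Y (representatives of U-classes); R^U only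
-- depends on the classes.

ultrapower : (P : Polarity) {I : Set} → Ultrafilter I → Polarity
ultrapower P {I} 𝒰 = record
  { X = I → Polarity.X P
  ; Y = I → Polarity.Y P
  ; R = λ f g → (λ i → Polarity.R P (f i) (g i)) ∈U
  }
  where open Ultrafilter 𝒰

-- The lattice ultrapower (P⁺)^U, as a setoid on representatives α : I → Stab

module LatticeUltrapower (P : Polarity) {I : Set} (𝒰 : Ultrafilter I) where
  open Plus P
  open Ultrafilter 𝒰

  Carrier : Set₁
  Carrier = I → Stab

  _≈U_ : Carrier → Carrier → Set
  α ≈U β = (λ i → proj₁ (α i) ≐ proj₁ (β i)) ∈U

  _∧U_ : Carrier → Carrier → Carrier
  (α ∧U β) i = α i ∧ₛ β i

  _∨U_ : Carrier → Carrier → Carrier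
  (α ∨U β) i = α i ∨ₛ β i

θ : (P : Polarity) {I : Set} (𝒰 : Ultrafilter I) →
    (I → Plus.Stab P) → Pred (I → Polarity.X P) 0ℓ
θ P 𝒰 α f = (λ i → proj₁ (α i) (f i)) ∈U
  where open Ultrafilter 𝒰

module Submission where

open import Defs
open import Level using (0ℓ)
open import Function using (_∘_)
open import Data.Product using (Σ; _×_; proj₁; proj₂; _,_)
open import Data.Sum using (_⊎_; inj₁; inj₂)
open import Data.Empty using (⊥-elim)
open import Relation.Nullary using (¬_; Dec; yes; no)
open import Relation.Unary using (Pred; _⊆_; _∩_; _∪_; _≐_; ∁)
open import Relation.Unary.Properties using (≐-sym; ≐-trans)
open import Axiom.ExcludedMiddle using (ExcludedMiddle)
open import Axiom.DoubleNegationElimination using (em⇒dne)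

-- Identify θ α with the ultraproduct of the family of stable
-- sets α i.  By Łoś's theorem for inclusions, an inclusion of ultraproducts
-- holds iff the inclusions hold U-almost everywhere; since ρ and λ are
-- defined by such inclusions, the closure λρ of P^U applied to an
-- ultraproduct is the ultraproduct of the closures.  For
-- density, a stable A ⊆ X^U is the intersection of the images of the
-- "columns" {x | x R g i} for g ∈ ρA and the closure of the union of
-- the images of the "rows" λ{f i} for f ∈ A.

module GaloisProperties {A B : Set} (R : A → B → Set) where
  open Galois R

  ρ-cong : ∀ {S S′} → S ≐ S′ → ρ S ≐ ρ S′
  ρ-cong (S⊆S′ , S′⊆S) = ρ-anti S′⊆S , ρ-anti S⊆S′

  Λ-cong : ∀ {T T′} → T ≐ T′ → Λ T ≐ Λ T′
  Λ-cong (T⊆T′ , T′⊆T) = Λ-anti T′⊆T , Λ-anti T⊆T′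

  Λ-stable : ∀ T → Stable (Λ T)
  Λ-stable T = Λ-anti unitʳ , unit

module Classical (lem : ExcludedMiddle 0ℓ) where
  ¬⊆⇒∃ : {Z : Set} {A B : Pred Z 0ℓ} → ¬ (A ⊆ B) →
         Σ Z λ z → A z × ¬ B z
  ¬⊆⇒∃ A⊈B = dne λ ∄ → A⊈B λ {z} a → dne λ ¬b → ∄ (z , a , ¬b)
    where dne = em⇒dne lem

  witnessOr : {Z : Set} {Q : Pred Z 0ℓ} → Z → Dec (Σ Z Q) → Z
  witnessOr _ (yes (z , _)) = z
  witnessOr z₀ (no _) = z₀

  witnessOr-sound : {Z : Set} {Q : Pred Z 0ℓ} (z₀ : Z) (d : Dec (Σ Z Q)) →
                    Σ Z Q → Q (witnessOr z₀ d)
  witnessOr-sound _ (yes (_ , q)) _ = q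
  witnessOr-sound _ (no ∄) w = ⊥-elim (∄ w)

module Ultraproduct {I : Set} (𝒰 : Ultrafilter I) where
  open Ultrafilter 𝒰

  everywhere⇒∈U : {S : Pred I 0ℓ} → (∀ i → S i) → S ∈U
  everywhere⇒∈U S-all = upward (λ {i} _ → S-all i) whole

  ∪-∈U : {S T : Pred I 0ℓ} → (S ∪ T) ∈U → S ∈U ⊎ T ∈U
  ∪-∈U {S} {T} S∪T∈U with ultra S
  ... | inj₁ S∈U = inj₁ S∈U
  ... | inj₂ ∁S∈U = inj₂ (upward onlyT (intersect S∪T∈U ∁S∈U))
    where
    onlyT : (S ∪ T) ∩ ∁ S ⊆ T
    onlyT (inj₁ s , ¬s) = ⊥-elim (¬s s)
    onlyT (inj₂ t , _) = t

  ultraproduct : {Z : Set} → (I → Pred Z 0ℓ) → Pred (I → Z) 0ℓ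
  ultraproduct A f = (λ i → A i (f i)) ∈U

  module _ {Z : Set} {A B : I → Pred Z 0ℓ} where

    ultraproduct-mono : (λ i → A i ⊆ B i) ∈U →
                        ultraproduct A ⊆ ultraproduct B
    ultraproduct-mono A⊆B f∈A =
      upward (λ (A⊆Bᵢ , a) → A⊆Bᵢ a) (intersect A⊆B f∈A)

    ultraproduct-∩ : ultraproduct (λ i → A i ∩ B i)
                     ≐ ultraproduct A ∩ ultraproduct B
    ultraproduct-∩ = (λ f∈A∩B → upward proj₁ f∈A∩B , upward proj₂ f∈A∩B)
                   , (λ (f∈A , f∈B) → intersect f∈A f∈B)

    ultraproduct-∪ : ultraproduct (λ i → A i ∪ B i)
                     ≐ ultraproduct A ∪ ultraproduct B
    ultraproduct-∪ = ∪-∈U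
                   , λ { (inj₁ f∈A) → upward inj₁ f∈A
                       ; (inj₂ f∈B) → upward inj₂ f∈B }

  ultraproduct-cong : {Z : Set} {A B : I → Pred Z 0ℓ} →
                      (λ i → A i ≐ B i) ∈U → ultraproduct A ≐ ultraproduct B
  ultraproduct-cong A≐B = ultraproduct-mono (upward proj₁ A≐B)
                        , ultraproduct-mono (upward proj₂ A≐B)

module Łoś (lem : ExcludedMiddle 0ℓ) {I : Set} (𝒰 : Ultrafilter I) where
  open Ultrafilter 𝒰
  open Classical lem
  open Ultraproduct 𝒰

  ∈U⇒nonempty : {S : Pred I 0ℓ} → S ∈U → Σ I S
  ∈U⇒nonempty {S} S∈U with lem {Σ I S}
  ... | yes s = s
  ... | no ∄ = ⊥-elim (proper (upward (λ {i} s → ∄ (i , s)) S∈U))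

  -- Off the witness set the chosen value is a default, available because
  -- a set in U is nonempty.
  ∈U-choice : {Z : Set} (Q : I → Pred Z 0ℓ) → (λ i → Σ Z (Q i)) ∈U →
              Σ (I → Z) λ f → (λ i → Q i (f i)) ∈U
  ∈U-choice {Z} Q Q∈U with ∈U⇒nonempty Q∈U
  ... | _ , z₀ , _ =
        (λ i → witnessOr z₀ (lem {Σ Z (Q i)}))
      , upward (λ {i} w → witnessOr-sound z₀ (lem {Σ Z (Q i)}) w) Q∈U

  -- Łoś's theorem for inclusions: counterexamples almost everywhere are
  -- glued by choice into a counterexample in the ultrapower.
  ultraproduct-mono⁻¹ : {Z : Set} {A B : I → Pred Z 0ℓ} →
                        ultraproduct A ⊆ ultraproduct B →
                        (λ i → A i ⊆ B i) ∈U
  ultraproduct-mono⁻¹ {A = A} {B} A⊆B with ultra (λ i → A i ⊆ B i)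
  ... | inj₁ A⊆B∈U = A⊆B∈U
  ... | inj₂ A⊈B∈U
      with ∈U-choice (λ i z → A i z × ¬ B i z) (upward ¬⊆⇒∃ A⊈B∈U)
  ...   | f , F = ⊥-elim (proper (upward (λ (b , _ , ¬b) → ¬b b)
                                         (intersect (A⊆B (upward proj₁ F)) F)))

  ultraproduct-injective : {Z : Set} {A B : I → Pred Z 0ℓ} →
                           ultraproduct A ≐ ultraproduct B →
                           (λ i → A i ≐ B i) ∈U
  ultraproduct-injective (A⊆B , B⊆A) =
    intersect (ultraproduct-mono⁻¹ A⊆B) (ultraproduct-mono⁻¹ B⊆A)

module UltrapowerClosure (lem : ExcludedMiddle 0ℓ)
                         (P : Polarity) {I : Set} (𝒰 : Ultrafilter I) where
  open Polarity P
  open Plus P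
  open Ultraproduct 𝒰
  open Łoś lem 𝒰
  module PU = Plus (ultrapower P 𝒰)
  module PUProperties = GaloisProperties (Polarity.R (ultrapower P 𝒰))

  ρᵁ-ultraproduct : (A : I → Pred X 0ℓ) →
                    PU.ρ (ultraproduct A) ≐ ultraproduct (λ i → ρ (A i))
  ρᵁ-ultraproduct A = ultraproduct-mono⁻¹ , ultraproduct-mono

  Λᵁ-ultraproduct : (B : I → Pred Y 0ℓ) →
                    PU.Λ (ultraproduct B) ≐ ultraproduct (λ i → Λ (B i))
  Λᵁ-ultraproduct B = ultraproduct-mono⁻¹ , ultraproduct-mono

  closureᵁ-ultraproduct : (A : I → Pred X 0ℓ) →
                          PU.Λ (PU.ρ (ultraproduct A))
                          ≐ ultraproduct (λ i → Λ (ρ (A i)))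
  closureᵁ-ultraproduct A =
    ≐-trans (PUProperties.Λ-cong (ρᵁ-ultraproduct A))
            (Λᵁ-ultraproduct (λ i → ρ (A i)))

  ultraproduct-stable : (α : I → Stab) → PU.Stable (ultraproduct (proj₁ ∘ α))
  ultraproduct-stable α =
    ≐-trans (closureᵁ-ultraproduct (proj₁ ∘ α))
            (ultraproduct-cong (everywhere⇒∈U (proj₂ ∘ α)))

  ultraproduct-join : (A B : I → Pred X 0ℓ) →
                      ultraproduct (λ i → Λ (ρ (A i ∪ B i)))
                      ≐ PU.Λ (PU.ρ (ultraproduct A ∪ ultraproduct B))
  ultraproduct-join A B =
    ≐-trans (≐-sym (closureᵁ-ultraproduct (λ i → A i ∪ B i)))
            (PUProperties.Λ-cong
              (PUProperties.ρ-cong (ultraproduct-∪ {A = A} {B})))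

module UltrapowerDensity (P : Polarity) {I : Set} (𝒰 : Ultrafilter I) where
  open Polarity P
  open Ultrafilter 𝒰
  open Plus P
  open GaloisProperties R using (Λ-stable)
  open Ultraproduct 𝒰
  module PU = Plus (ultrapower P 𝒰)

  column : Y → Stab
  column y = (λ x → R x y) , (λ x∈Λρ → x∈Λρ λ r → r) , unit

  row : X → Stab
  row x = Λ (R x) , Λ-stable (R x)

  meet-dense : (A : PU.Stab) → Σ Set λ J → Σ (J → I → Stab) λ a →
               proj₁ A ≐ (λ f → ∀ j → θ P 𝒰 (a j) f)
  meet-dense (A , A-stable) =
      Σ (I → Y) (PU.ρ A)
    , (λ (g , _) i → column (g i))
    , (λ f∈A (_ , g∈ρA) → g∈ρA f∈A)
    , (λ f∈cols → proj₁ A-stable λ {g} g∈ρA → f∈cols (g , g∈ρA))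

  row-⊆ : (A : PU.Stab) {f : I → X} → proj₁ A f → θ P 𝒰 (row ∘ f) ⊆ proj₁ A
  row-⊆ (A , A-stable) f∈A h∈row = proj₁ A-stable λ g∈ρA →
    upward (λ (r , l) → l r) (intersect (g∈ρA f∈A) h∈row)

  join-dense : (A : PU.Stab) → Σ Set λ J → Σ (J → I → Stab) λ a →
               proj₁ A ≐ PU.Λ (PU.ρ (λ f → Σ J λ j → θ P 𝒰 (a j) f))
  join-dense A =
      Σ (I → X) (proj₁ A)
    , (λ (f , _) → row ∘ f)
    , (λ {f} f∈A → PU.unit ((f , f∈A) , everywhere⇒∈U λ i {_} r → r))
    , (λ f∈closure → proj₁ (proj₂ A) (PU.Λ-anti (PU.ρ-anti rows⊆A) f∈closure))
    where
    rows⊆A : (λ h → Σ (Σ (I → X) (proj₁ A)) λ (f , _) → θ P 𝒰 (row ∘ f) h)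
             ⊆ proj₁ A
    rows⊆A ((_ , f∈A) , h∈row) = row-⊆ A f∈A h∈row

theorem6p1 : ExcludedMiddle 0ℓ →
    (P : Polarity) (I : Set) (𝒰 : Ultrafilter I) →
    let open LatticeUltrapower P 𝒰
        module PU = Plus (ultrapower P 𝒰)
        θ′ = θ P 𝒰
    in
    (∀ α β → α ≈U β → θ′ α ≐ θ′ β)
    × (∀ α → PU.Stable (θ′ α))
    × (∀ α β → θ′ α ≐ θ′ β → α ≈U β)
    × (∀ α β → θ′ (α ∧U β) ≐ (θ′ α ∩ θ′ β))
    × (∀ α β → θ′ (α ∨U β) ≐ PU.Λ (PU.ρ (θ′ α ∪ θ′ β)))
    × (∀ (A : PU.Stab) → Σ Set λ J → Σ (J → Carrier) λ a →
    proj₁ A ≐ (λ f → ∀ j → θ′ (a j) f))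
    × (∀ (A : PU.Stab) → Σ Set λ J → Σ (J → Carrier) λ a →
    proj₁ A ≐ PU.Λ (PU.ρ (λ f → Σ J λ j → θ′ (a j) f)))
theorem6p1 lem P I 𝒰 =
    (λ _ _ → ultraproduct-cong)
  , ultraproduct-stable
  , (λ _ _ → ultraproduct-injective)
  , (λ α β → ultraproduct-∩ {A = proj₁ ∘ α} {proj₁ ∘ β})
  , (λ α β → ultraproduct-join (proj₁ ∘ α) (proj₁ ∘ β))
  , meet-dense
  , join-dense
  where
  open Ultraproduct 𝒰
  open Łoś lem 𝒰
  open UltrapowerClosure lem P 𝒰
  open UltrapowerDensity P 𝒰
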